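{- Let $A=\{(a_1,b_1),(a_2,b_2),\dots,(a_m,b_m)\}$ where the $a_i,b_i$ are non-negative integers. Let $a$ be the smallest non-zero $a_i$, $a'$ the largest $a_i$, $b$ the smallest non-zero $b_i$, $b'$ the largest $b_i$, and $N=\max\{2a'^2,2b'^2\}$. Suppose $a$ and $a'$ are coprime, $b$ and $b'$ are coprime, and $$\{(0,0),(a,0),(0,b),(a',0),(0,b'),(a,b'),(a',b),(a',b'),(a,b)\}\subset A.$$ Then for every integer $k\geq N$, $|kA-kA|\geq|kA+kA|$.
   Context: $kA=\{u_1+\cdots+u_k:u_i\in A\}$ denotes the $k$-fold sumset of $A$; $kA+kA$ and $kA-kA$ are the sumset and difference set of $kA$. -}

module Defs where

open import Data.Nat as ℕ using (ℕ; zero; suc)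
open import Data.Integer as ℤ using (ℤ)
open import Data.Product using (_×_; _,_; proj₁; proj₂)
open import Data.Product.Properties using (≡-dec)
open import Data.List using (List; []; _∷_; [_]; map; length; deduplicate; cartesianProductWith)
open import Relation.Binary.PropositionalEquality using (_≡_)
open import Relation.Nullary using (Dec)

Pt : Set
Pt = ℤ × ℤ

_⊕_ : Pt → Pt → Pt
(x , y) ⊕ (u , v) = (x ℤ.+ u , y ℤ.+ v)

_⊖_ : Pt → Pt → Pt
(x , y) ⊖ (u , v) = (x ℤ.- u , y ℤ.- v)

_≟Pt_ : (p q : Pt) → Dec (p ≡ q)
_≟Pt_ = ≡-dec ℤ._≟_ ℤ._≟_

emb : ℕ × ℕ → Pt
emb (x , y) = (ℤ.+ x , ℤ.+ y)

-- S + T and S - T (as lists, possibly with repetitions)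
_+ˢ_ : List Pt → List Pt → List Pt
S +ˢ T = cartesianProductWith _⊕_ S T

_-ˢ_ : List Pt → List Pt → List Pt
S -ˢ T = cartesianProductWith _⊖_ S T

_·_ : ℕ → List Pt → List Pt
zero  · A = [ (ℤ.+ 0 , ℤ.+ 0) ]
suc k · A = A +ˢ (k · A)

card : List Pt → ℕ
card S = length (deduplicate _≟Pt_ S)

-- Only the corners of the bounding box [0,a′] × [0,b′] matter. Any 2k points of A can be
-- rearranged, without changing their number or their coordinate sums, into fewer than a′b′ points
-- of A followed by corners: as long as a′b′ points remain, two of the a′b′ + 1 suffix sums agree
-- modulo (a′, b′), so some block of consecutive points sums to (i a′, j b′) and can be traded for
-- corners. For k ≥ a′b′ at least k corners appear; reflecting k of them through the centre of
-- the box turns s + t − k(a′, b′), for s, t ∈ kA, into a difference v − w with v, w ∈ kA. So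
-- translation by −k(a′, b′) injects kA + kA into kA − kA.
module Submission where

open import Defs
open import Data.Nat using (ℕ; _≤_; _*_; _⊔_; NonZero)
open import Data.Nat.Coprimality using (Coprime)
open import Data.Product using (_×_; _,_; proj₁; proj₂)
open import Data.List using (List; map)
open import Data.List.Membership.Propositional using (_∈_)
open import Relation.Binary.PropositionalEquality using (_≡_)
open import Relation.Nullary using (¬_)

open import Data.Nat using (zero; suc; pred; _+_; _∸_; _<_; _%_; _/_; z≤n; s≤s; z<s; _<?_; ≢-nonZero; >-nonZero⁻¹)
open import Data.Nat.Properties
open import Data.Nat.DivMod using (m≡m%n+[m/n]*n; m%n<n)
open import Data.Nat.Divisibility using (_∣_; divides; ∣m+n∣m⇒∣n; n∣m*n)
import Data.Nat.Tactic.RingSolver as ℕ-Solver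
open import Data.Integer as ℤ using (ℤ; +_)
import Data.Integer.Properties as ℤ
import Data.Integer.Tactic.RingSolver as ℤ-Solver
open import Algebra.Properties.AbelianGroup ℤ.+-0-abelianGroup using (∙-cancelʳ)
open import Data.Product using (∃; ∃₂)
open import Data.Product.Properties using (≡-dec)
open import Data.Sum using (_⊎_; inj₁; inj₂)
open import Data.List using ([]; _∷_; _++_; length; tails; upTo; cartesianProduct; deduplicate)
open import Data.List.Properties using (length-++; length-map; map-++; ++-assoc; length-upTo)
open import Data.Nat.ListAction using (sum)
open import Data.Nat.ListAction.Properties using (sum-++)
open import Data.List.Membership.Propositional.Properties
  using (∈-map⁻; ∈-map⁺; ∈-upTo⁺; ∈-cartesianProduct⁺; ∈-cartesianProductWith⁺; ∈-cartesianProductWith⁻;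
         ∈-deduplicate⁺; ∈-deduplicate⁻)
import Data.List.Membership.DecPropositional as DecMembership
open import Data.List.Relation.Binary.Subset.Propositional using (_⊆_)
open import Data.List.Relation.Unary.Any using (here; there)
open import Data.List.Relation.Unary.All as All using (All; []; _∷_)
open import Data.List.Relation.Unary.All.Properties using (++⁺; ++⁻; map⁺; ¬Any⇒All¬)
open import Data.List.Relation.Unary.AllPairs using ([]; _∷_)
open import Data.List.Relation.Unary.Unique.Propositional using (Unique)
import Data.List.Relation.Unary.Unique.Propositional.Properties as Unique
open import Data.List.Relation.Unary.Unique.DecPropositional.Properties _≟Pt_ using (deduplicate-!)
open import Function using (_∘_)
open import Function.Definitions using (Injective)
open import Relation.Binary.Definitions using (DecidableEquality)
open import Relation.Binary.PropositionalEquality using (_≢_; refl; sym; trans; cong; cong₂; subst; module ≡-Reasoning)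
open import Relation.Nullary using (yes; no; contradiction)

module _ {X : Set} where

  ∈⇒∃-deletion : ∀ {x : X} {ys} → x ∈ ys →
               ∃ λ zs → length ys ≡ suc (length zs) × (∀ {y} → y ∈ ys → y ≢ x → y ∈ zs)
  ∈⇒∃-deletion {ys = _ ∷ ys} (here refl) =
    ys , refl , λ { (here y≡x) y≢x → contradiction y≡x y≢x ; (there y∈ys) _ → y∈ys }
  ∈⇒∃-deletion {ys = y ∷ ys} (there x∈ys) with zs , eq , keep ← ∈⇒∃-deletion x∈ys =
    y ∷ zs , cong suc eq , λ { (here refl) _ → here refl ; (there w∈ys) w≢x → there (keep w∈ys w≢x) }

  Unique-length-≤ : ∀ {xs ys : List X} → Unique xs → xs ⊆ ys → length xs ≤ length ys
  Unique-length-≤ {[]} _ _ = z≤n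
  Unique-length-≤ {x ∷ xs} (x∉xs ∷ unique) xs⊆ys with zs , eq , keep ← ∈⇒∃-deletion (xs⊆ys (here refl)) =
    subst (suc (length xs) ≤_) (sym eq) (s≤s (Unique-length-≤ unique xs⊆zs))
    where
    xs⊆zs : xs ⊆ zs
    xs⊆zs y∈xs = keep (xs⊆ys (there y∈xs)) (λ y≡x → All.lookup x∉xs y∈xs (sym y≡x))

card-≤-of-injection : (f : Pt → Pt) → Injective _≡_ _≡_ f →
                      ∀ {S T} → (∀ {z} → z ∈ S → f z ∈ T) → card S ≤ card T
card-≤-of-injection f f-injective {S} {T} f[S]⊆T = begin
  card S                                ≡⟨ length-map f (deduplicate _≟Pt_ S) ⟨
  length (map f (deduplicate _≟Pt_ S))  ≤⟨ Unique-length-≤ (Unique.map⁺ f-injective (deduplicate-! S)) image⊆ ⟩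
  card T                                ∎
  where
  open ≤-Reasoning
  image⊆ : map f (deduplicate _≟Pt_ S) ⊆ deduplicate _≟Pt_ T
  image⊆ y∈ with x , x∈ , refl ← ∈-map⁻ f y∈ = ∈-deduplicate⁺ _≟Pt_ (f[S]⊆T (∈-deduplicate⁻ _≟Pt_ S x∈))

∈-tails⁻ : ∀ {X : Set} {S L : List X} → S ∈ tails L → ∃ λ M → L ≡ M ++ S
∈-tails⁻ (here refl) = [] , refl
∈-tails⁻ {L = []} (there ())
∈-tails⁻ {L = x ∷ L} (there S∈) with M , refl ← ∈-tails⁻ S∈ = x ∷ M , refl

length-tails : ∀ {X : Set} (L : List X) → length (tails L) ≡ suc (length L)
length-tails [] = refl
length-tails (x ∷ L) = cong suc (length-tails L)

repeatedTail-or-Unique : ∀ {X Y : Set} → DecidableEquality Y → (f : List X → Y) → ∀ L →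
  (∃₂ λ Pre M → ∃ λ S → L ≡ Pre ++ M ++ S × 0 < length M × f (M ++ S) ≡ f S)
  ⊎ Unique (map f (tails L))
repeatedTail-or-Unique _≟_ f [] = inj₂ ([] ∷ [])
repeatedTail-or-Unique _≟_ f (x ∷ L) with repeatedTail-or-Unique _≟_ f L
... | inj₁ (Pre , M , S , refl , nonempty , repeat) = inj₁ (x ∷ Pre , M , S , refl , nonempty , repeat)
... | inj₂ unique with f (x ∷ L) ∈? map f (tails L)
  where open DecMembership _≟_ using (_∈?_)
...   | no fresh = inj₂ (¬Any⇒All¬ _ fresh ∷ unique)
...   | yes seen with S , S∈ , repeat ← ∈-map⁻ f seen with M , refl ← ∈-tails⁻ S∈ =
  inj₁ ([] , x ∷ M , S , refl , z<s , repeat)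

length-cartesianProduct : ∀ {X Y : Set} (xs : List X) (ys : List Y) →
                          length (cartesianProduct xs ys) ≡ length xs * length ys
length-cartesianProduct [] ys = refl
length-cartesianProduct (x ∷ xs) ys =
  trans (length-++ (map (x ,_) ys)) (cong₂ _+_ (length-map _ ys) (length-cartesianProduct xs ys))

+-%-≡⇒∣ : ∀ m n d .{{_ : NonZero d}} → (m + n) % d ≡ n % d → d ∣ m
+-%-≡⇒∣ m n d eq = ∣m+n∣m⇒∣n (divides ((m + n) / d) multiple) (n∣m*n (n / d))
  where
  open ≡-Reasoning
  multiple : n / d * d + m ≡ (m + n) / d * d
  multiple = +-cancelˡ-≡ (n % d) _ _ (begin
    n % d + (n / d * d + m)        ≡⟨ +-assoc (n % d) _ m ⟨
    n % d + n / d * d + m          ≡⟨ cong (_+ m) (m≡m%n+[m/n]*n n d) ⟨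
    n + m                          ≡⟨ +-comm n m ⟩
    m + n                          ≡⟨ m≡m%n+[m/n]*n (m + n) d ⟩
    (m + n) % d + (m + n) / d * d  ≡⟨ cong (_+ (m + n) / d * d) eq ⟩
    n % d + (m + n) / d * d        ∎)

x+w≡v+c⇒x-c≡v-w : ∀ {x w v c : ℤ} → x ℤ.+ w ≡ v ℤ.+ c → x ℤ.- c ≡ v ℤ.- w
x+w≡v+c⇒x-c≡v-w {x} {w} {v} {c} eq = begin
  x ℤ.- c                  ≡⟨ shift x c w ⟩
  (x ℤ.+ w) ℤ.- (c ℤ.+ w)  ≡⟨ cong₂ ℤ._-_ eq (ℤ.+-comm c w) ⟩
  (v ℤ.+ c) ℤ.- (w ℤ.+ c)  ≡⟨ shift v w c ⟨
  v ℤ.- w                  ∎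
  where
  open ≡-Reasoning
  shift : ∀ x y z → x ℤ.- y ≡ (x ℤ.+ z) ℤ.- (y ℤ.+ z)
  shift = ℤ-Solver.solve-∀

m+n≡o+p⇒m-p≡o-n : ∀ {m n o p} → m + n ≡ o + p → + m ℤ.- + p ≡ + o ℤ.- + n
m+n≡o+p⇒m-p≡o-n {m} {n} {o} {p} eq =
  x+w≡v+c⇒x-c≡v-w {+ m} {+ n} {+ o} {+ p} (trans (sym (ℤ.pos-+ m n)) (trans (cong +_ eq) (ℤ.pos-+ o p)))

⊖-cancelʳ : ∀ c → Injective _≡_ _≡_ (_⊖ c)
⊖-cancelʳ (c₁ , c₂) {x₁ , x₂} {y₁ , y₂} eq =
  cong₂ _,_ (∙-cancelʳ (ℤ.- c₁) x₁ y₁ (cong proj₁ eq)) (∙-cancelʳ (ℤ.- c₂) x₂ y₂ (cong proj₂ eq))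

splitAt-≤ : ∀ {X : Set} k (Z : List X) → k ≤ length Z → ∃₂ λ Z₁ Z₂ → Z ≡ Z₁ ++ Z₂ × length Z₁ ≡ k
splitAt-≤ zero Z _ = [] , Z , refl , refl
splitAt-≤ (suc k) (z ∷ Z) (s≤s k≤|Z|) with Z₁ , Z₂ , refl , refl ← splitAt-≤ k Z k≤|Z| = z ∷ Z₁ , Z₂ , refl , refl

m*n≤2m*m⊔2n*n : ∀ m n → m * n ≤ 2 * (m * m) ⊔ 2 * (n * n)
m*n≤2m*m⊔2n*n m n with ≤-total m n
... | inj₁ m≤n = ≤-trans (*-monoˡ-≤ n m≤n) (≤-trans (m≤m+n (n * n) _) (m≤n⊔m (2 * (m * m)) _))
... | inj₂ n≤m = ≤-trans (*-monoʳ-≤ m n≤m) (≤-trans (m≤m+n (m * m) _) (m≤m⊔n _ (2 * (n * n))))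

data Axis : Set where
  horizontal vertical : Axis

coord : Axis → ℕ × ℕ → ℕ
coord horizontal = proj₁
coord vertical   = proj₂

∑ : Axis → List (ℕ × ℕ) → ℕ
∑ a L = sum (map (coord a) L)

∑-++ : ∀ a xs ys → ∑ a (xs ++ ys) ≡ ∑ a xs + ∑ a ys
∑-++ a xs ys = trans (cong sum (map-++ (coord a) xs ys)) (sum-++ (map (coord a) xs) _)

total : List (ℕ × ℕ) → ℕ × ℕ
total L = ∑ horizontal L , ∑ vertical L

∈-·⁻ : ∀ {A : List (ℕ × ℕ)} k {z} → z ∈ k · map emb A →
       ∃ λ L → All (_∈ A) L × length L ≡ k × z ≡ emb (total L)
∈-·⁻ zero (here refl) = [] , [] , refl , refl
∈-·⁻ {A} (suc k) z∈ with e , s , e∈ , s∈ , refl ← ∈-cartesianProductWith⁻ _⊕_ (map emb A) (k · map emb A) z∈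
                     with u , u∈A , refl ← ∈-map⁻ emb e∈
                     with L , L⊆A , refl , refl ← ∈-·⁻ k s∈ = u ∷ L , u∈A ∷ L⊆A , refl , refl

∈-·⁺ : ∀ {A : List (ℕ × ℕ)} {k L} → All (_∈ A) L → length L ≡ k → emb (total L) ∈ k · map emb A
∈-·⁺ [] refl = here refl
∈-·⁺ (u∈A ∷ L⊆A) refl = ∈-cartesianProductWith⁺ _⊕_ (∈-map⁺ emb u∈A) (∈-·⁺ L⊆A refl)

infix 4 _∼_

record _∼_ (L M : List (ℕ × ℕ)) : Set where
  field
    length-≡ : length L ≡ length M
    ∑-≡      : ∀ a → ∑ a L ≡ ∑ a M

open _∼_

module Additive (h : List (ℕ × ℕ) → ℕ) (h-++ : ∀ xs ys → h (xs ++ ys) ≡ h xs + h ys) where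

  cong-++ : ∀ {L L′ M M′} → h L ≡ h L′ → h M ≡ h M′ → h (L ++ M) ≡ h (L′ ++ M′)
  cong-++ {L} {L′} {M} {M′} L≡ M≡ = trans (h-++ L M) (trans (cong₂ _+_ L≡ M≡) (sym (h-++ L′ M′)))

  move-middle : ∀ Pre B S → h (Pre ++ B ++ S) ≡ h (Pre ++ S) + h B
  move-middle Pre B S = begin
    h (Pre ++ B ++ S)        ≡⟨ trans (h-++ Pre (B ++ S)) (cong (_+_ (h Pre)) (h-++ B S)) ⟩
    h Pre + (h B + h S)      ≡⟨ swap (h Pre) (h B) (h S) ⟩
    h Pre + h S + h B        ≡⟨ cong (_+ h B) (h-++ Pre S) ⟨
    h (Pre ++ S) + h B       ∎
    where
    open ≡-Reasoning
    swap : ∀ x y z → x + (y + z) ≡ x + z + y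
    swap = ℕ-Solver.solve-∀

module Length = Additive length (λ xs _ → length-++ xs)
module Sum (a : Axis) = Additive (∑ a) (∑-++ a)

∼-refl : ∀ {L} → L ∼ L
∼-refl = record { length-≡ = refl ; ∑-≡ = λ _ → refl }

∼-reflexive : ∀ {L M} → L ≡ M → L ∼ M
∼-reflexive refl = ∼-refl

∼-trans : ∀ {L M N} → L ∼ M → M ∼ N → L ∼ N
∼-trans L∼M M∼N = record
  { length-≡ = trans (length-≡ L∼M) (length-≡ M∼N)
  ; ∑-≡      = λ a → trans (∑-≡ L∼M a) (∑-≡ M∼N a)
  }

∼-++ : ∀ {L L′ M M′} → L ∼ L′ → M ∼ M′ → L ++ M ∼ L′ ++ M′
∼-++ {L} {L′} {M} {M′} L∼ M∼ = record
  { length-≡ = Length.cong-++ {L} {L′} {M} {M′} (length-≡ L∼) (length-≡ M∼)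
  ; ∑-≡      = λ a → Sum.cong-++ a {L} {L′} {M} {M′} (∑-≡ L∼ a) (∑-≡ M∼ a)
  }

∼-replace-middle : ∀ {B C} Pre S → B ∼ C → Pre ++ B ++ S ∼ (Pre ++ S) ++ C
∼-replace-middle {B} {C} Pre S B∼C = record
  { length-≡ = replace (Length.move-middle Pre B S) (length-≡ B∼C) (length-++ (Pre ++ S))
  ; ∑-≡      = λ a → replace (Sum.move-middle a Pre B S) (∑-≡ B∼C a) (∑-++ a (Pre ++ S) C)
  }
  where
  replace : ∀ {x y z u v} → x ≡ y + z → z ≡ u → v ≡ y + u → x ≡ v
  replace x≡ refl v≡ = trans x≡ (sym v≡)

data Endpoint (m : ℕ) : ℕ → Set where
  low  : Endpoint m 0
  high : Endpoint m m

Endpoint-≤ : ∀ {m x} → Endpoint m x → x ≤ m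
Endpoint-≤ low  = z≤n
Endpoint-≤ high = ≤-refl

Endpoint-∸ : ∀ {m x} → Endpoint m x → Endpoint m (m ∸ x)
Endpoint-∸ low          = high
Endpoint-∸ {m} high     = subst (Endpoint m) (sym (n∸n≡0 m)) low

level : ℕ → ℕ → ℕ
level zero    m = 0
level (suc _) m = m

levels : ℕ → ℕ → ℕ → List ℕ
levels zero    n m = []
levels (suc l) n m = level n m ∷ levels l (pred n) m

sum-levels : ∀ {l n} m → n ≤ l → sum (levels l n m) ≡ n * m
sum-levels {zero}  m z≤n      = refl
sum-levels {suc l} {zero} m _ = sum-levels m (z≤n {l})
sum-levels {suc l} {suc n} m (s≤s n≤l) = cong (_+_ m) (sum-levels m n≤l)

Endpoint-level : ∀ n m → Endpoint m (level n m)
Endpoint-level zero    m = low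
Endpoint-level (suc _) m = high

module Box (p q : ℕ) {{p≢0 : NonZero p}} {{q≢0 : NonZero q}} where

  side : Axis → ℕ
  side horizontal = p
  side vertical   = q

  side-nonZero : ∀ a → NonZero (side a)
  side-nonZero horizontal = p≢0
  side-nonZero vertical   = q≢0

  InBox : ℕ × ℕ → Set
  InBox u = ∀ a → coord a u ≤ side a

  Corner : ℕ × ℕ → Set
  Corner u = ∀ a → Endpoint (side a) (coord a u)

  Corner⇒InBox : ∀ {u} → Corner u → InBox u
  Corner⇒InBox corner a = Endpoint-≤ (corner a)

  complement : ℕ × ℕ → ℕ × ℕ
  complement u = p ∸ proj₁ u , q ∸ proj₂ u

  Corner-complement : ∀ {u} → Corner u → Corner (complement u)
  Corner-complement corner horizontal = Endpoint-∸ (corner horizontal)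
  Corner-complement corner vertical   = Endpoint-∸ (corner vertical)

  coord-+-complement : ∀ a {u} → coord a u ≤ side a → coord a u + coord a (complement u) ≡ side a
  coord-+-complement horizontal = m+[n∸m]≡n
  coord-+-complement vertical   = m+[n∸m]≡n

  ∑-complement : ∀ a {Z} → All InBox Z → ∑ a Z + ∑ a (map complement Z) ≡ length Z * side a
  ∑-complement a [] = refl
  ∑-complement a {u ∷ Z} (u-in ∷ Z-in) = begin
    (coord a u + ∑ a Z) + (coord a (complement u) + ∑ a (map complement Z))
      ≡⟨ interchange (coord a u) (∑ a Z) _ _ ⟩
    (coord a u + coord a (complement u)) + (∑ a Z + ∑ a (map complement Z))
      ≡⟨ cong₂ _+_ (coord-+-complement a (u-in a)) (∑-complement a Z-in) ⟩
    side a + length Z * side a ∎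
    where
    open ≡-Reasoning
    interchange : ∀ w x y z → (w + x) + (y + z) ≡ (w + y) + (x + z)
    interchange = ℕ-Solver.solve-∀

  ∑-reflect-middle : ∀ {L R Z₁ Z₂} → L ∼ R ++ Z₁ ++ Z₂ → All InBox Z₁ → ∀ a →
                     ∑ a L + ∑ a (map complement Z₁) ≡ ∑ a (R ++ Z₂) + length Z₁ * side a
  ∑-reflect-middle {L} {R} {Z₁} {Z₂} form Z₁⊆box a = begin
    ∑ a L + ∑ a W                       ≡⟨ cong (_+ ∑ a W) (trans (∑-≡ form a) (Sum.move-middle a R Z₁ Z₂)) ⟩
    ∑ a (R ++ Z₂) + ∑ a Z₁ + ∑ a W      ≡⟨ +-assoc (∑ a (R ++ Z₂)) _ _ ⟩
    ∑ a (R ++ Z₂) + (∑ a Z₁ + ∑ a W)    ≡⟨ cong (_+_ (∑ a (R ++ Z₂))) (∑-complement a Z₁⊆box) ⟩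
    ∑ a (R ++ Z₂) + length Z₁ * side a  ∎
    where
    open ≡-Reasoning
    W : List (ℕ × ℕ)
    W = map complement Z₁

  ∑-≤ : ∀ a {L} → All InBox L → ∑ a L ≤ length L * side a
  ∑-≤ a []             = z≤n
  ∑-≤ a (u-in ∷ L-in) = +-mono-≤ (u-in a) (∑-≤ a L-in)

  cornerWalk : ℕ → (Axis → ℕ) → List (ℕ × ℕ)
  cornerWalk zero    index = []
  cornerWalk (suc l) index = (level (index horizontal) p , level (index vertical) q) ∷ cornerWalk l (pred ∘ index)

  length-cornerWalk : ∀ l index → length (cornerWalk l index) ≡ l
  length-cornerWalk zero    index = refl
  length-cornerWalk (suc l) index = cong suc (length-cornerWalk l _)

  map-coord-cornerWalk : ∀ a l index → map (coord a) (cornerWalk l index) ≡ levels l (index a) (side a)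
  map-coord-cornerWalk horizontal zero    index = refl
  map-coord-cornerWalk vertical   zero    index = refl
  map-coord-cornerWalk horizontal (suc l) index = cong (_ ∷_) (map-coord-cornerWalk horizontal l (pred ∘ index))
  map-coord-cornerWalk vertical   (suc l) index = cong (_ ∷_) (map-coord-cornerWalk vertical l (pred ∘ index))

  cornerWalk-corners : ∀ l index → All Corner (cornerWalk l index)
  cornerWalk-corners zero    index = []
  cornerWalk-corners (suc l) index = corner ∷ cornerWalk-corners l (pred ∘ index)
    where
    corner : Corner (level (index horizontal) p , level (index vertical) q)
    corner horizontal = Endpoint-level (index horizontal) p
    corner vertical   = Endpoint-level (index vertical) q

  divisible-block-∼-corners : ∀ {B} → All InBox B → (∀ a → side a ∣ ∑ a B) → ∃ λ C → All Corner C × B ∼ C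
  divisible-block-∼-corners {B} B-in divisible =
    cornerWalk (length B) index , cornerWalk-corners (length B) index ,
    record { length-≡ = sym (length-cornerWalk (length B) index) ; ∑-≡ = ∑-≡-cornerWalk }
    where
    index : Axis → ℕ
    index a with divides i _ ← divisible a = i
    ∑-≡-index : ∀ a → ∑ a B ≡ index a * side a
    ∑-≡-index a with divides i eq ← divisible a = eq
    ∑-≡-cornerWalk : ∀ a → ∑ a B ≡ ∑ a (cornerWalk (length B) index)
    ∑-≡-cornerWalk a = begin
      ∑ a B                                        ≡⟨ ∑-≡-index a ⟩
      index a * side a                             ≡⟨ sum-levels (side a) index≤|B| ⟨
      sum (levels (length B) (index a) (side a))  ≡⟨ cong sum (map-coord-cornerWalk a (length B) index) ⟨
      ∑ a (cornerWalk (length B) index)                  ∎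
      where
      open ≡-Reasoning
      index≤|B| : index a ≤ length B
      index≤|B| = *-cancelʳ-≤ (index a) (length B) (side a) {{side-nonZero a}}
                    (subst (_≤ length B * side a) (∑-≡-index a) (∑-≤ a B-in))

  residue : List (ℕ × ℕ) → ℕ × ℕ
  residue S = ∑ horizontal S % p , ∑ vertical S % q

  residues : List (ℕ × ℕ)
  residues = cartesianProduct (upTo p) (upTo q)

  residue∈residues : ∀ S → residue S ∈ residues
  residue∈residues S = ∈-cartesianProduct⁺ (∈-upTo⁺ (m%n<n _ p)) (∈-upTo⁺ (m%n<n _ q))

  divisible-block : ∀ L → p * q ≤ length L →
    ∃₂ λ Pre B → ∃ λ S → L ≡ Pre ++ B ++ S × 0 < length B × (∀ a → side a ∣ ∑ a B)
  divisible-block L pq≤|L| with repeatedTail-or-Unique (≡-dec _≟_ _≟_) residue L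
  ... | inj₁ (Pre , B , S , split , nonempty , repeat) = Pre , B , S , split , nonempty , divisible
    where
    divisible : ∀ a → side a ∣ ∑ a B
    divisible horizontal = +-%-≡⇒∣ _ _ p (trans (cong (_% p) (sym (∑-++ horizontal B S))) (cong proj₁ repeat))
    divisible vertical   = +-%-≡⇒∣ _ _ q (trans (cong (_% q) (sym (∑-++ vertical B S))) (cong proj₂ repeat))
  ... | inj₂ unique = contradiction pq≤|L| (<⇒≱ (begin-strict
    length L                          <⟨ n<1+n (length L) ⟩
    suc (length L)                    ≡⟨ length-tails L ⟨
    length (tails L)                  ≡⟨ length-map residue (tails L) ⟨
    length (map residue (tails L))    ≤⟨ Unique-length-≤ unique tails-residues⊆ ⟩
    length residues                   ≡⟨ length-cartesianProduct (upTo p) (upTo q) ⟩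
    length (upTo p) * length (upTo q) ≡⟨ cong₂ _*_ (length-upTo p) (length-upTo q) ⟩
    p * q                             ∎))
    where
    open ≤-Reasoning
    tails-residues⊆ : map residue (tails L) ⊆ residues
    tails-residues⊆ r∈ with S , _ , refl ← ∈-map⁻ residue {xs = tails L} r∈ = residue∈residues S

  module Points (A : List (ℕ × ℕ)) (A⊆box : ∀ {u} → u ∈ A → InBox u) (corners∈A : ∀ {u} → Corner u → u ∈ A) where

    shorten : ∀ {R} → All (_∈ A) R → p * q ≤ length R →
              ∃₂ λ R′ C → All (_∈ A) R′ × All Corner C × length R′ < length R × R ∼ R′ ++ C
    shorten {R} R⊆A pq≤|R| with Pre , B , S , refl , nonempty , divisible ← divisible-block R pq≤|R| = shortened
      where
      Pre⊆A : All (_∈ A) Pre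
      Pre⊆A = proj₁ (++⁻ Pre R⊆A)
      B⊆A : All (_∈ A) B
      B⊆A = proj₁ (++⁻ B (proj₂ (++⁻ Pre R⊆A)))
      S⊆A : All (_∈ A) S
      S⊆A = proj₂ (++⁻ B (proj₂ (++⁻ Pre R⊆A)))
      shorter : length (Pre ++ S) < length (Pre ++ B ++ S)
      shorter = subst (length (Pre ++ S) <_) (sym (Length.move-middle Pre B S)) (m<m+n _ nonempty)
      shortened : ∃₂ λ R′ C → All (_∈ A) R′ × All Corner C × length R′ < length (Pre ++ B ++ S) ×
                              Pre ++ B ++ S ∼ R′ ++ C
      shortened with C , C-corners , B∼C ← divisible-block-∼-corners (All.map A⊆box B⊆A) divisible =
        Pre ++ S , C , ++⁺ Pre⊆A S⊆A , C-corners , shorter , ∼-replace-middle Pre S B∼C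

    record CornerForm (L : List (ℕ × ℕ)) : Set where
      constructor corner-form
      field
        short corners : List (ℕ × ℕ)
        short⊆A       : All (_∈ A) short
        all-corners   : All Corner corners
        short-length  : length short < p * q
        form          : L ∼ short ++ corners

    cornerForm : ∀ {L} → All (_∈ A) L → CornerForm L
    cornerForm [] = corner-form [] [] [] [] (>-nonZero⁻¹ (p * q) {{m*n≢0 p q}}) ∼-refl
    cornerForm {u ∷ L} (u∈A ∷ L⊆A) with corner-form R Z R⊆A Z-corners |R|<pq L∼ ← cornerForm L⊆A
                                   with suc (length R) <? p * q
    ... | yes fits = corner-form (u ∷ R) Z (u∈A ∷ R⊆A) Z-corners fits (∼-++ {u ∷ []} ∼-refl L∼)
    ... | no full with R′ , C , R′⊆A , C-corners , shorter , R∼ ← shorten (u∈A ∷ R⊆A) (≮⇒≥ full) =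
      corner-form R′ (C ++ Z) R′⊆A (++⁺ C-corners Z-corners) (<-≤-trans shorter |R|<pq)
        (∼-trans (∼-++ {u ∷ []} ∼-refl L∼) (∼-trans (∼-++ R∼ ∼-refl) (∼-reflexive (++-assoc R′ C Z))))

    SumAsDifference : ℕ → List (ℕ × ℕ) → List (ℕ × ℕ) → Set
    SumAsDifference k Ls Lt = ∃₂ λ V W → All (_∈ A) V × All (_∈ A) W × length V ≡ k × length W ≡ k ×
                                         (∀ a → ∑ a Ls + ∑ a Lt + ∑ a W ≡ ∑ a V + k * side a)

    sum-pair-as-difference : ∀ {k} → p * q ≤ k → ∀ {Ls Lt} → All (_∈ A) Ls → All (_∈ A) Lt →
                             length Ls ≡ k → length Lt ≡ k → SumAsDifference k Ls Lt
    sum-pair-as-difference {k} pq≤k {Ls} {Lt} Ls⊆A Lt⊆A |Ls| |Lt| =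
      from-corner-form (cornerForm (++⁺ Ls⊆A Lt⊆A))
      where
      open ≡-Reasoning
      |Ls++Lt| : length (Ls ++ Lt) ≡ k + k
      |Ls++Lt| = trans (length-++ Ls) (cong₂ _+_ |Ls| |Lt|)
      k≤|Z| : ∀ {R Z} → length R < p * q → Ls ++ Lt ∼ R ++ Z → k ≤ length Z
      k≤|Z| {R} |R|<pq form = ≮⇒≥ λ |Z|<k →
        <-irrefl (trans (sym (length-++ R)) (trans (sym (length-≡ form)) |Ls++Lt|))
                 (+-mono-< (<-≤-trans |R|<pq pq≤k) |Z|<k)
      from-corner-form : CornerForm (Ls ++ Lt) → SumAsDifference k Ls Lt
      from-corner-form (corner-form R Z R⊆A Z-corners |R|<pq form)
        with Z₁ , Z₂ , refl , |Z₁| ← splitAt-≤ k Z (k≤|Z| {R} {Z} |R|<pq form) =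
        R ++ Z₂ , map complement Z₁ , ++⁺ R⊆A (All.map corners∈A Z₂-corners) ,
        map⁺ (All.map (corners∈A ∘ Corner-complement) Z₁-corners) , |V| ,
        trans (length-map complement Z₁) |Z₁| , balance
        where
        Z₁-corners : All Corner Z₁
        Z₁-corners = proj₁ (++⁻ Z₁ Z-corners)
        Z₁⊆box : All InBox Z₁
        Z₁⊆box = All.map Corner⇒InBox Z₁-corners
        Z₂-corners : All Corner Z₂
        Z₂-corners = proj₂ (++⁻ Z₁ Z-corners)
        |V| : length (R ++ Z₂) ≡ k
        |V| = +-cancelʳ-≡ k _ _ (begin
          length (R ++ Z₂) + k           ≡⟨ cong (_+_ (length (R ++ Z₂))) |Z₁| ⟨
          length (R ++ Z₂) + length Z₁   ≡⟨ Length.move-middle R Z₁ Z₂ ⟨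
          length (R ++ Z₁ ++ Z₂)         ≡⟨ length-≡ form ⟨
          length (Ls ++ Lt)              ≡⟨ |Ls++Lt| ⟩
          k + k                          ∎)
        balance : ∀ a → ∑ a Ls + ∑ a Lt + ∑ a (map complement Z₁) ≡ ∑ a (R ++ Z₂) + k * side a
        balance a = begin
          ∑ a Ls + ∑ a Lt + ∑ a (map complement Z₁)  ≡⟨ cong (_+ ∑ a (map complement Z₁)) (∑-++ a Ls Lt) ⟨
          ∑ a (Ls ++ Lt) + ∑ a (map complement Z₁)   ≡⟨ ∑-reflect-middle {R = R} {Z₂ = Z₂} form Z₁⊆box a ⟩
          ∑ a (R ++ Z₂) + length Z₁ * side a         ≡⟨ cong (λ l → ∑ a (R ++ Z₂) + l * side a) |Z₁| ⟩
          ∑ a (R ++ Z₂) + k * side a                 ∎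

    sumset-card-≤-diffset-card : ∀ k → p * q ≤ k → let kA = k · map emb A in card (kA +ˢ kA) ≤ card (kA -ˢ kA)
    sumset-card-≤-diffset-card k pq≤k = card-≤-of-injection (_⊖ shift) (⊖-cancelʳ shift) difference
      where
      kA : List Pt
      kA = k · map emb A
      shift : Pt
      shift = + (k * p) , + (k * q)
      difference : ∀ {z} → z ∈ kA +ˢ kA → z ⊖ shift ∈ kA -ˢ kA
      difference z∈ with s , t , s∈ , t∈ , refl ← ∈-cartesianProductWith⁻ _⊕_ kA kA z∈
                    with Ls , Ls⊆A , |Ls| , refl ← ∈-·⁻ k s∈
                    with Lt , Lt⊆A , |Lt| , refl ← ∈-·⁻ k t∈
                    with V , W , V⊆A , W⊆A , |V| , |W| , balance ← sum-pair-as-difference pq≤k Ls⊆A Lt⊆A |Ls| |Lt| =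
        subst (_∈ kA -ˢ kA) (sym (cong₂ _,_ (coordinate horizontal) (coordinate vertical)))
          (∈-cartesianProductWith⁺ _⊖_ (∈-·⁺ V⊆A |V|) (∈-·⁺ W⊆A |W|))
        where
        coordinate : ∀ a → + (∑ a Ls + ∑ a Lt) ℤ.- + (k * side a) ≡ + ∑ a V ℤ.- + ∑ a W
        coordinate a = m+n≡o+p⇒m-p≡o-n {∑ a Ls + ∑ a Lt} {∑ a W} {∑ a V} {k * side a} (balance a)

lemma3p10 : (A : List (ℕ × ℕ)) (a a′ b b′ : ℕ) →
    -- a is the smallest non-zero first coordinate
    ¬ (a ≡ 0) → a ∈ map proj₁ A → (∀ x → x ∈ map proj₁ A → ¬ (x ≡ 0) → a ≤ x) →
    -- a′ is the largest first coordinate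
    a′ ∈ map proj₁ A → (∀ x → x ∈ map proj₁ A → x ≤ a′) →
    -- b is the smallest non-zero second coordinate
    ¬ (b ≡ 0) → b ∈ map proj₂ A → (∀ y → y ∈ map proj₂ A → ¬ (y ≡ 0) → b ≤ y) →
    -- b′ is the largest second coordinate
    b′ ∈ map proj₂ A → (∀ y → y ∈ map proj₂ A → y ≤ b′) →
    Coprime a a′ → Coprime b b′ →
    (0 , 0) ∈ A → (a , 0) ∈ A → (0 , b) ∈ A → (a′ , 0) ∈ A → (0 , b′) ∈ A →
    (a , b′) ∈ A → (a′ , b) ∈ A → (a′ , b′) ∈ A → (a , b) ∈ A →
    (k : ℕ) → (2 * (a′ * a′)) ⊔ (2 * (b′ * b′)) ≤ k →
    let kA = k · map emb A in
    card (kA +ˢ kA) ≤ card (kA -ˢ kA)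
lemma3p10 A a a′ b b′ a≢0 a∈ _ _ a′-max b≢0 b∈ _ _ b′-max _ _ 00∈A _ _ a′0∈A 0b′∈A _ _ a′b′∈A _ k N≤k =
  Points.sumset-card-≤-diffset-card A in-box corners∈A k (≤-trans (m*n≤2m*m⊔2n*n a′ b′) N≤k)
  where
  a′≢0 : NonZero a′
  a′≢0 = ≢-nonZero λ a′≡0 → a≢0 (n≤0⇒n≡0 (subst (a ≤_) a′≡0 (a′-max a a∈)))
  b′≢0 : NonZero b′
  b′≢0 = ≢-nonZero λ b′≡0 → b≢0 (n≤0⇒n≡0 (subst (b ≤_) b′≡0 (b′-max b b∈)))
  open Box a′ b′ {{a′≢0}} {{b′≢0}}
  in-box : ∀ {u} → u ∈ A → InBox u
  in-box u∈A horizontal = a′-max _ (∈-map⁺ proj₁ u∈A)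
  in-box u∈A vertical   = b′-max _ (∈-map⁺ proj₂ u∈A)
  corners∈A : ∀ {u} → Corner u → u ∈ A
  corners∈A corner with corner horizontal | corner vertical
  ... | low  | low  = 00∈A
  ... | high | low  = a′0∈A
  ... | low  | high = 0b′∈A
  ... | high | high = a′b′∈A
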